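{- Let $p$ be a prime, $n\in\mathbb{Z}^+$, $d\in[0,n]$ and $\ell=\ell_p(d)=\lceil\log_p(d+1)\rceil$. Over $\mathbb{F}_p$: (a) If $i\notin[d,n-d]$, then $\operatorname{Z\text{ - }cl}_{n,d}(i)=\{i\}$. (b) If $i\in[d,n-d]$, then $\operatorname{Z\text{ - }cl}_{n,d}(i)\subseteq i\oplus p^\ell$, where $i\oplus p^\ell=\{t\in[0,n]:t\equiv i\pmod{p^\ell}\}$.
   Context: For integers $a\le b$, $[a,b]$ denotes the set of integers between $a$ and $b$. Work over $\mathbb{F}_p$ with $\{0,1\}^n\subseteq\mathbb{F}_p^n$; $|x|$ is the Hamming weight, and for $E\subseteq[0,n]$, $\underline{E}=\{x\in\{0,1\}^n:|x|\in E\}$. The degree-$d$ Zariski closure $\operatorname{Z\text{ - }cl}_{n,d}(\underline{E})$ is the set of $y\in\{0,1\}^n$ at which every polynomial in $\mathbb{F}_p[X_1,\dots,X_n]$ of degree at most $d$ vanishing on $\underline{E}$ also vanishes; it is symmetric and is identified with its set of Hamming weights $\operatorname{Z\text{ - }cl}_{n,d}(E)\subseteq[0,n]$; $\operatorname{Z\text{ - }cl}_{n,d}(i)$ means $\operatorname{Z\text{ - }cl}_{n,d}(\{i\})$. -}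

module Defs where

open import Data.Nat using (ℕ; zero; suc; _+_; _*_; _^_; _≤_; _<_)
open import Data.Nat.Divisibility using (_∣_)
open import Data.Bool using (Bool; true; false; if_then_else_)
open import Data.Vec using (Vec; []; _∷_)
open import Data.List using (List; []; _∷_)
open import Data.List.Relation.Unary.All using (All)
open import Data.Product using (Σ; ∃; ∃-syntax; _×_)
open import Data.Sum using (_⊎_)
open import Relation.Binary.PropositionalEquality using (_≡_)

-- Points of {0,1}^n ⊆ F_p^n : Boolean vectors (true ↦ 1, false ↦ 0).
Cube : ℕ → Set
Cube n = Vec Bool n

weight : ∀ {n} → Cube n → ℕ
weight []            = 0
weight (true  ∷ xs)  = suc (weight xs)
weight (false ∷ xs)  = weight xs

-- A monomial c · X^e with coefficient c (a natural number read in F_p = ℕ/pℕ)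
-- and exponent vector e ∈ ℕ^n.
record Monomial (n : ℕ) : Set where
  constructor mono
  field
    coeff : ℕ
    expo  : Vec ℕ n

Poly : ℕ → Set
Poly n = List (Monomial n)

totalDeg : ∀ {n} → Vec ℕ n → ℕ
totalDeg []       = 0
totalDeg (e ∷ es) = e + totalDeg es

DegLe : ∀ {n} → ℕ → Poly n → Set
DegLe d P = All (λ m → totalDeg (Monomial.expo m) ≤ d) P

bit : Bool → ℕ
bit true  = 1
bit false = 0

evalExpo : ∀ {n} → Vec ℕ n → Cube n → ℕ
evalExpo []       []       = 1
evalExpo (e ∷ es) (b ∷ bs) = bit b ^ e * evalExpo es bs

-- Value of P at x, computed in ℕ; its residue mod p is the value in F_p.
evalPoly : ∀ {n} → Poly n → Cube n → ℕ
evalPoly []                 x = 0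
evalPoly (mono c e ∷ ms)    x = c * evalExpo e x + evalPoly ms x

VanishesAt : ℕ → ∀ {n} → Poly n → Cube n → Set
VanishesAt p P x = p ∣ evalPoly P x

-- y lies in the degree-d Zariski closure (over F_p) of the slice set E̲,
-- where E ⊆ [0,n] is given as a predicate on weights.
InZcl : (p n d : ℕ) → (E : ℕ → Set) → Cube n → Set
InZcl p n d E y =
  (P : Poly n) → DegLe d P →
  ((x : Cube n) → E (weight x) → VanishesAt p P x) →
  VanishesAt p P y

-- Weight t belongs to Z-cl_{n,d}(E) ⊆ [0,n] (closure is symmetric; identified
-- with its set of Hamming weights).
ZclW : (p n d : ℕ) → (E : ℕ → Set) → ℕ → Set
ZclW p n d E t = ∃[ y ] (weight {n} y ≡ t × InZcl p n d E y)

ZclPt : (p n d i : ℕ) → ℕ → Set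
ZclPt p n d i = ZclW p n d (λ s → s ≡ i)

-- ℓ = ⌈log_p m⌉ : the least ℓ with m ≤ p^ℓ.
IsCeilLog : (p m ℓ : ℕ) → Set
IsCeilLog p m ℓ = (m ≤ p ^ ℓ) × (∀ k → m ≤ p ^ k → ℓ ≤ k)

_≡_[mod_] : ℕ → ℕ → ℕ → Set
a ≡ b [mod m ] = ∃[ k ] (a ≡ b + k * m ⊎ b ≡ a + k * m)

-- For i < d the closure of the slice of weight i is the slice itself: e_i − 1 (e_i the elementary
-- symmetric polynomial, valued (|x| C i) on the cube) cuts off smaller weights, and a monomial of degree
-- i + 1 cuts off larger ones; the degree-preserving substitution X ↦ 1 − X swaps weights t and n − t,
-- which covers i > n − d. For (b), whenever p ^ j ≤ d the polynomial e_{p^j} − (i C p^j) vanishes on the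
-- slice, so every weight t of the closure has (t C p^j) ≡ (i C p^j) (mod p). As (1 + X) ^ (p^j) ≡
-- 1 + X ^ (p^j) over 𝔽_p, (t C p^j) is congruent to the j-th base-p digit of t, so t and i share their
-- ℓ lowest digits.
module Submission where

open import Defs
open import Data.Nat
open import Data.Nat.Properties
open import Data.Nat.Divisibility
open import Data.Nat.DivMod
open import Data.Nat.Combinatorics using (_C_; nCn≡1; nC1≡n; k>n⇒nCk≡0; nCk+nC[k+1]≡[n+1]C[k+1])
open import Data.Nat.Primality using (Prime; euclidsLemma; prime⇒nonZero; prime⇒nonTrivial)
open import Data.Nat.Tactic.RingSolver using (solve-∀)
open import Data.Bool using (true; false; not)
open import Data.Vec using (Vec; []; _∷_; replicate; map)
open import Data.List using ([]; _∷_; _++_)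
open import Data.List.Relation.Unary.All using ([]; _∷_)
import Data.List.Relation.Unary.All as All
open import Data.List.Relation.Unary.All.Properties using (++⁺)
open import Data.Product using (∃-syntax; _×_; _,_)
import Data.Product as Product
open import Data.Sum using (_⊎_; inj₁; inj₂; [_,_]′)
import Data.Sum as Sum
open import Relation.Binary.Definitions using (tri<; tri≈; tri>)
open import Relation.Binary.PropositionalEquality
open import Relation.Nullary using (contradiction)
open import Function using (_∘_; id)
open import Function.Bundles using (_⇔_; mk⇔)
open import Algebra.Properties.CommutativeSemigroup +-commutativeSemigroup using () renaming (interchange to +-interchange)
open ≡-Reasoning

[1+k]*[1+n]C[1+k]≡[1+n]*nCk : ∀ n k → suc k * (suc n C suc k) ≡ suc n * (n C k)
[1+k]*[1+n]C[1+k]≡[1+n]*nCk zero    zero    = refl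
[1+k]*[1+n]C[1+k]≡[1+n]*nCk zero    (suc k) = *-zeroʳ (2 + k)
[1+k]*[1+n]C[1+k]≡[1+n]*nCk (suc n) zero    =
  trans (+-identityʳ _) (trans (nC1≡n (2 + n)) (sym (*-identityʳ (2 + n))))
[1+k]*[1+n]C[1+k]≡[1+n]*nCk (suc n) (suc k) = begin
  (2 + k) * ((2 + n) C (2 + k))    ≡⟨ cong ((2 + k) *_) (nCk+nC[k+1]≡[n+1]C[k+1] (suc n) (suc k)) ⟨
  (2 + k) * (a + b)                ≡⟨ *-distribˡ-+ (2 + k) a b ⟩
  a + (1 + k) * a + (2 + k) * b    ≡⟨ cong₂ (λ u v → a + u + v) ([1+k]*[1+n]C[1+k]≡[1+n]*nCk n k)
                                                               ([1+k]*[1+n]C[1+k]≡[1+n]*nCk n (suc k)) ⟩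
  a + (1 + n) * c + (1 + n) * e    ≡⟨ +-assoc a _ _ ⟩
  a + ((1 + n) * c + (1 + n) * e)  ≡⟨ cong (a +_) (*-distribˡ-+ (suc n) c e) ⟨
  a + (1 + n) * (c + e)            ≡⟨ cong (λ u → a + (1 + n) * u) (nCk+nC[k+1]≡[n+1]C[k+1] n k) ⟩
  (2 + n) * a                      ∎
  where a = suc n C suc k; b = suc n C (2 + k); c = n C k; e = n C suc k

-- shiftedC q a k is the coefficient of X ^ k in X ^ q * (1 + X) ^ a.
shiftedC : ℕ → ℕ → ℕ → ℕ
shiftedC zero    a k       = a C k
shiftedC (suc q) a zero    = 0
shiftedC (suc q) a (suc k) = shiftedC q a k

shiftedC-suc : ∀ q a k → shiftedC q (suc a) k ≡ shiftedC (suc q) a k + shiftedC q a k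
shiftedC-suc zero    a zero    = refl
shiftedC-suc zero    a (suc k) = sym (nCk+nC[k+1]≡[n+1]C[k+1] a k)
shiftedC-suc (suc q) a zero    = refl
shiftedC-suc (suc q) a (suc k) = shiftedC-suc q a k

shiftedC-diag : ∀ q a → shiftedC q a q ≡ 1
shiftedC-diag zero    a = refl
shiftedC-diag (suc q) a = shiftedC-diag q a

shiftedC-0 : ∀ q k → k ≢ q → shiftedC q 0 k ≡ 0
shiftedC-0 zero    zero    k≢q = contradiction refl k≢q
shiftedC-0 zero    (suc k) k≢q = refl
shiftedC-0 (suc q) zero    k≢q = refl
shiftedC-0 (suc q) (suc k) k≢q = shiftedC-0 q k (k≢q ∘ cong suc)

-- (1 + X) ^ q ≡ 1 + X ^ q over 𝔽_p
FreshmansDream : ℕ → ℕ → Set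
FreshmansDream p q = ∀ k → 0 < k → k < q → p ∣ q C k

module _ (p : ℕ) .{{_ : NonZero p}} where

  %-cong-+ : ∀ {a b c e} → a % p ≡ b % p → c % p ≡ e % p → (a + c) % p ≡ (b + e) % p
  %-cong-+ {a} {b} {c} {e} a≡b c≡e = begin
    (a + c) % p          ≡⟨ %-distribˡ-+ a c p ⟩
    (a % p + c % p) % p  ≡⟨ cong₂ (λ u v → (u + v) % p) a≡b c≡e ⟩
    (b % p + e % p) % p  ≡⟨ %-distribˡ-+ b e p ⟨
    (b + e) % p          ∎

  -- Coefficient of X ^ k in (1 + X) ^ (a + q) ≡ (1 + X) ^ a + X ^ q (1 + X) ^ a.
  C-shift : ∀ {q} → FreshmansDream p (suc q) → ∀ a k →
            ((a + suc q) C k) % p ≡ (a C k + shiftedC (suc q) a k) % p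
  C-shift dream zero    zero    = refl
  C-shift {q} dream zero (suc k) with <-cmp k q
  ... | tri< k<q _ _ = begin
    (suc q C suc k) % p ≡⟨ n∣m⇒m%n≡0 _ p (dream (suc k) z<s (s<s k<q)) ⟩
    0                   ≡⟨ m<n⇒m%n≡m (>-nonZero⁻¹ p) ⟨
    0 % p               ≡⟨ cong (_% p) (shiftedC-0 q k (<⇒≢ k<q)) ⟨
    shiftedC q 0 k % p  ∎
  ... | tri≈ _ refl _ = cong (_% p) (trans (nCn≡1 (suc q)) (sym (shiftedC-diag q 0)))
  ... | tri> _ _ q<k  = cong (_% p) (trans (k>n⇒nCk≡0 (s<s q<k)) (sym (shiftedC-0 q k (>⇒≢ q<k))))
  C-shift dream (suc a) zero    = refl
  C-shift {q} dream (suc a) (suc k) = begin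
    (suc (a + suc q) C suc k) % p                        ≡⟨ cong (_% p) (nCk+nC[k+1]≡[n+1]C[k+1] (a + suc q) k) ⟨
    ((a + suc q) C k + (a + suc q) C suc k) % p          ≡⟨ %-cong-+ (C-shift dream a k) (C-shift dream a (suc k)) ⟩
    ((a C k + s k) + (a C suc k + shiftedC q a k)) % p   ≡⟨ cong (_% p) (+-interchange (a C k) (s k) _ _) ⟩
    ((a C k + a C suc k) + (s k + shiftedC q a k)) % p   ≡⟨ cong₂ (λ u v → (u + v) % p)
                                                              (nCk+nC[k+1]≡[n+1]C[k+1] a k) (sym (shiftedC-suc q a k)) ⟩
    (suc a C suc k + shiftedC q (suc a) k) % p           ∎
    where s = shiftedC (suc q) a

  C-multiple : ∀ {q} → FreshmansDream p (suc q) → ∀ m {r} → r < suc q → ((m * suc q + r) C suc q) % p ≡ m % p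
  C-multiple dream zero    r<q = cong (_% p) (k>n⇒nCk≡0 r<q)
  C-multiple {q} dream (suc m) {r} r<q = begin
    ((suc m * suc q + r) C suc q) % p                   ≡⟨ cong (λ a → (a C suc q) % p) (rearrange (suc q) m r) ⟩
    ((a + suc q) C suc q) % p                           ≡⟨ C-shift dream a (suc q) ⟩
    (a C suc q + shiftedC (suc q) a (suc q)) % p        ≡⟨ %-cong-+ (C-multiple dream m r<q) (cong (_% p) (shiftedC-diag q a)) ⟩
    (m + 1) % p                                         ≡⟨ cong (_% p) (+-comm m 1) ⟩
    suc m % p                                           ∎
    where
    a = m * suc q + r
    rearrange : ∀ q m r → suc m * q + r ≡ m * q + r + q
    rearrange = solve-∀

  C-by-quotient : ∀ {q} .{{_ : NonZero q}} → FreshmansDream p q → ∀ a → (a C q) % p ≡ (a / q) % p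
  C-by-quotient {suc q} dream a = begin
    (a C suc q) % p                                ≡⟨ cong (λ b → (b C suc q) % p) (m≡m%n+[m/n]*n a (suc q)) ⟩
    ((a % suc q + a / suc q * suc q) C suc q) % p  ≡⟨ cong (λ b → (b C suc q) % p) (+-comm (a % suc q) _) ⟩
    ((a / suc q * suc q + a % suc q) C suc q) % p  ≡⟨ C-multiple dream (a / suc q) (m%n<n a (suc q)) ⟩
    (a / suc q) % p                                ∎

  digit : ℕ → ℕ → ℕ
  digit a j = (a / p ^ j) {{m^n≢0 p j}} % p

  digit-suc : ∀ a j → digit a (suc j) ≡ digit (a / p) j
  digit-suc a j = cong (_% p) (sym (m/n/o≡m/[n*o] a p (p ^ j) {{_}} {{m^n≢0 p j}} {{m^n≢0 p (suc j)}}))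

  digit-zero : ∀ a → digit a 0 ≡ a % p
  digit-zero a = cong (_% p) (n/1≡n a)

  ≡-mod-p^-by-digits : ∀ ℓ {w i} → (∀ j → j < ℓ → digit w j ≡ digit i j) → w ≡ i [mod p ^ ℓ ]
  ≡-mod-p^-by-digits zero {w} {i} _ with ≤-total i w
  ... | inj₁ i≤w = w ∸ i , inj₁ (trans (sym (m+[n∸m]≡n i≤w)) (cong (i +_) (sym (*-identityʳ _))))
  ... | inj₂ w≤i = i ∸ w , inj₂ (trans (sym (m+[n∸m]≡n w≤i)) (cong (w +_) (sym (*-identityʳ _))))
  ≡-mod-p^-by-digits (suc ℓ) {w} {i} digits with ≡-mod-p^-by-digits ℓ {w / p} {i / p} higher-digits
    where
    higher-digits : ∀ j → j < ℓ → digit (w / p) j ≡ digit (i / p) j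
    higher-digits j j<ℓ = subst₂ _≡_ (digit-suc w j) (digit-suc i j) (digits (suc j) (s<s j<ℓ))
  ... | k , w/p≡i/p = k , Sum.map (combine last-digit) (combine (sym last-digit)) w/p≡i/p
    where
    last-digit : w % p ≡ i % p
    last-digit = subst₂ _≡_ (digit-zero w) (digit-zero i) (digits 0 z<s)
    combine : ∀ {a b} → a % p ≡ b % p → a / p ≡ b / p + k * p ^ ℓ → a ≡ b + k * p ^ suc ℓ
    combine {a} {b} a%p≡b%p a/p≡ = begin
      a                                    ≡⟨ m≡m%n+[m/n]*n a p ⟩
      a % p + a / p * p                    ≡⟨ cong₂ (λ u v → u + v * p) a%p≡b%p a/p≡ ⟩
      b % p + (b / p + k * p ^ ℓ) * p      ≡⟨ regroup (b % p) (b / p) k (p ^ ℓ) p ⟩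
      b % p + b / p * p + k * (p * p ^ ℓ)  ≡⟨ cong (_+ k * (p * p ^ ℓ)) (m≡m%n+[m/n]*n b p) ⟨
      b + k * p ^ suc ℓ                    ∎
      where
      regroup : ∀ r a k Q p → r + (a + k * Q) * p ≡ r + a * p + k * (p * Q)
      regroup = solve-∀

-- q divides k · (q C k) = q · ((q - 1) C (k - 1)) but not k.
freshmansDream : ∀ {p q} → (∀ {m n} → q ∣ m * n → q ∣ m ⊎ p ∣ n) → FreshmansDream p q
freshmansDream {q = suc q} split (suc k) _ k<q = [ (λ q∣k → contradiction (∣⇒≤ q∣k) (<⇒≱ k<q)) , id ]′
  (split (divides (q C k) (trans ([1+k]*[1+n]C[1+k]≡[1+n]*nCk q k) (*-comm (suc q) (q C k)))))

module _ {p : ℕ} (p-prime : Prime p) where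

  private instance
    p-nonZero : NonZero p
    p-nonZero = prime⇒nonZero p-prime

  p^j∣m*n⇒p^j∣m⊎p∣n : ∀ j {m n} → p ^ j ∣ m * n → p ^ j ∣ m ⊎ p ∣ n
  p^j∣m*n⇒p^j∣m⊎p∣n zero    {m}     _ = inj₁ (1∣ m)
  p^j∣m*n⇒p^j∣m⊎p∣n (suc j) {m} {n} p^[1+j]∣mn
    with euclidsLemma m n p-prime (∣-trans (m∣m*n (p ^ j)) p^[1+j]∣mn)
  ... | inj₂ p∣n = inj₂ p∣n
  ... | inj₁ (divides m′ refl) = Sum.map₁ p^j∣m′⇒p^[1+j]∣m′p (p^j∣m*n⇒p^j∣m⊎p∣n j p^j∣m′n)
    where
    p^j∣m′n : p ^ j ∣ m′ * n
    p^j∣m′n = *-cancelˡ-∣ p (subst (p ^ suc j ∣_) (trans (cong (_* n) (*-comm m′ p)) (*-assoc p m′ n)) p^[1+j]∣mn)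
    p^j∣m′⇒p^[1+j]∣m′p : p ^ j ∣ m′ → p ^ suc j ∣ m′ * p
    p^j∣m′⇒p^[1+j]∣m′p p^j∣m′ = subst (p ^ suc j ∣_) (*-comm p m′) (*-monoʳ-∣ p p^j∣m′)

  [a]C[p^j]≡digit : ∀ a j → (a C p ^ j) % p ≡ digit p a j
  [a]C[p^j]≡digit a j = C-by-quotient p {{_}} {{m^n≢0 p j}} (freshmansDream (p^j∣m*n⇒p^j∣m⊎p∣n j)) a

weight≤n : ∀ {n} (x : Cube n) → weight x ≤ n
weight≤n []          = z≤n
weight≤n (true ∷ x)  = s≤s (weight≤n x)
weight≤n (false ∷ x) = m≤n⇒m≤1+n (weight≤n x)

weight-map-not : ∀ {n} (x : Cube n) → weight (map not x) ≡ n ∸ weight x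
weight-map-not []          = refl
weight-map-not (true ∷ x)  = weight-map-not x
weight-map-not (false ∷ x) = trans (cong suc (weight-map-not x)) (sym (+-∸-assoc 1 (weight≤n x)))

∃-weight : ∀ {n k} → k ≤ n → ∃[ x ] weight {n} x ≡ k
∃-weight {zero}          z≤n       = [] , refl
∃-weight {suc n} {zero}  _         = Product.map (false ∷_) id (∃-weight z≤n)
∃-weight {suc n} {suc k} (s≤s k≤n) = Product.map (true ∷_) (cong suc) (∃-weight k≤n)

constant : ∀ n → ℕ → Poly n
constant n c = mono c (replicate n 0) ∷ []

weaken : ∀ {n} → Poly n → Poly (suc n)
weaken []             = []
weaken (mono c e ∷ P) = mono c (0 ∷ e) ∷ weaken P

X₀* : ∀ {n} → Poly n → Poly (suc n)
X₀* []             = []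
X₀* (mono c e ∷ P) = mono c (1 ∷ e) ∷ X₀* P

scale : ∀ {n} → ℕ → Poly n → Poly n
scale s []             = []
scale s (mono c e ∷ P) = mono (s * c) e ∷ scale s P

evalPoly-++ : ∀ {n} (P Q : Poly n) x → evalPoly (P ++ Q) x ≡ evalPoly P x + evalPoly Q x
evalPoly-++ []             Q x = refl
evalPoly-++ (mono c e ∷ P) Q x =
  trans (cong (c * evalExpo e x +_) (evalPoly-++ P Q x)) (sym (+-assoc (c * evalExpo e x) _ _))

evalPoly-constant : ∀ n c (x : Cube n) → evalPoly (constant n c) x ≡ c
evalPoly-constant n c x = begin
  c * evalExpo (replicate n 0) x + 0  ≡⟨ +-identityʳ _ ⟩
  c * evalExpo (replicate n 0) x      ≡⟨ cong (c *_) (evalExpo-0 x) ⟩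
  c * 1                               ≡⟨ *-identityʳ c ⟩
  c                                   ∎
  where
  evalExpo-0 : ∀ {n} (x : Cube n) → evalExpo (replicate n 0) x ≡ 1
  evalExpo-0 []      = refl
  evalExpo-0 (b ∷ x) = trans (+-identityʳ _) (evalExpo-0 x)

evalPoly-weaken : ∀ {n} (P : Poly n) b x → evalPoly (weaken P) (b ∷ x) ≡ evalPoly P x
evalPoly-weaken []             b x = refl
evalPoly-weaken (mono c e ∷ P) b x =
  cong₂ _+_ (cong (c *_) (+-identityʳ (evalExpo e x))) (evalPoly-weaken P b x)

evalPoly-X₀*-true : ∀ {n} (P : Poly n) x → evalPoly (X₀* P) (true ∷ x) ≡ evalPoly P x
evalPoly-X₀*-true []             x = refl
evalPoly-X₀*-true (mono c e ∷ P) x =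
  cong₂ _+_ (cong (c *_) (+-identityʳ (evalExpo e x))) (evalPoly-X₀*-true P x)

evalPoly-X₀*-false : ∀ {n} (P : Poly n) x → evalPoly (X₀* P) (false ∷ x) ≡ 0
evalPoly-X₀*-false []             x = refl
evalPoly-X₀*-false (mono c e ∷ P) x = cong₂ _+_ (*-zeroʳ c) (evalPoly-X₀*-false P x)

evalPoly-scale : ∀ {n} s (P : Poly n) x → evalPoly (scale s P) x ≡ s * evalPoly P x
evalPoly-scale s []             x = sym (*-zeroʳ s)
evalPoly-scale s (mono c e ∷ P) x =
  trans (cong₂ _+_ (*-assoc s c _) (evalPoly-scale s P x)) (sym (*-distribˡ-+ s _ _))

DegLe-mono : ∀ {n a b} {P : Poly n} → a ≤ b → DegLe a P → DegLe b P
DegLe-mono a≤b = All.map (λ deg≤a → ≤-trans deg≤a a≤b)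

DegLe-constant : ∀ n c d → DegLe d (constant n c)
DegLe-constant n c d = subst (_≤ d) (sym (totalDeg-0 n)) z≤n ∷ []
  where
  totalDeg-0 : ∀ n → totalDeg (replicate n 0) ≡ 0
  totalDeg-0 zero    = refl
  totalDeg-0 (suc n) = totalDeg-0 n

DegLe-weaken : ∀ {n d} {P : Poly n} → DegLe d P → DegLe d (weaken P)
DegLe-weaken []         = []
DegLe-weaken (h ∷ degP) = h ∷ DegLe-weaken degP

DegLe-X₀* : ∀ {n d} {P : Poly n} → DegLe d P → DegLe (suc d) (X₀* P)
DegLe-X₀* []         = []
DegLe-X₀* (h ∷ degP) = s≤s h ∷ DegLe-X₀* degP

DegLe-scale : ∀ {n d s} {P : Poly n} → DegLe d P → DegLe d (scale s P)
DegLe-scale []         = []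
DegLe-scale (h ∷ degP) = h ∷ DegLe-scale degP

elementary : ∀ n → ℕ → Poly n
elementary n       zero    = constant n 1
elementary zero    (suc k) = []
elementary (suc n) (suc k) = X₀* (elementary n k) ++ weaken (elementary n (suc k))

evalPoly-elementary : ∀ n k (x : Cube n) → evalPoly (elementary n k) x ≡ weight x C k
evalPoly-elementary n       zero    x           = evalPoly-constant n 1 x
evalPoly-elementary zero    (suc k) []          = refl
evalPoly-elementary (suc n) (suc k) (true ∷ x)  = begin
  evalPoly (X₀* (elementary n k) ++ weaken (elementary n (suc k))) (true ∷ x)
    ≡⟨ evalPoly-++ (X₀* (elementary n k)) _ _ ⟩
  evalPoly (X₀* (elementary n k)) (true ∷ x) + evalPoly (weaken (elementary n (suc k))) (true ∷ x)
    ≡⟨ cong₂ _+_ (evalPoly-X₀*-true (elementary n k) x) (evalPoly-weaken (elementary n (suc k)) true x) ⟩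
  evalPoly (elementary n k) x + evalPoly (elementary n (suc k)) x
    ≡⟨ cong₂ _+_ (evalPoly-elementary n k x) (evalPoly-elementary n (suc k) x) ⟩
  weight x C k + weight x C suc k
    ≡⟨ nCk+nC[k+1]≡[n+1]C[k+1] (weight x) k ⟩
  suc (weight x) C suc k
    ∎
evalPoly-elementary (suc n) (suc k) (false ∷ x) = begin
  evalPoly (X₀* (elementary n k) ++ weaken (elementary n (suc k))) (false ∷ x)
    ≡⟨ evalPoly-++ (X₀* (elementary n k)) _ _ ⟩
  evalPoly (X₀* (elementary n k)) (false ∷ x) + evalPoly (weaken (elementary n (suc k))) (false ∷ x)
    ≡⟨ cong₂ _+_ (evalPoly-X₀*-false (elementary n k) x) (evalPoly-weaken (elementary n (suc k)) false x) ⟩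
  evalPoly (elementary n (suc k)) x
    ≡⟨ evalPoly-elementary n (suc k) x ⟩
  weight x C suc k
    ∎

DegLe-elementary : ∀ n k → DegLe k (elementary n k)
DegLe-elementary n       zero    = DegLe-constant n 1 0
DegLe-elementary zero    (suc k) = []
DegLe-elementary (suc n) (suc k) =
  ++⁺ (DegLe-X₀* (DegLe-elementary n k)) (DegLe-weaken (DegLe-elementary n (suc k)))

monomial : ∀ {n} → Cube n → Poly n
monomial []          = constant 0 1
monomial (true ∷ s)  = X₀* (monomial s)
monomial (false ∷ s) = weaken (monomial s)

DegLe-monomial : ∀ {n} (s : Cube n) → DegLe (weight s) (monomial s)
DegLe-monomial []          = DegLe-constant 0 1 0
DegLe-monomial (true ∷ s)  = DegLe-X₀* (DegLe-monomial s)
DegLe-monomial (false ∷ s) = DegLe-weaken (DegLe-monomial s)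

evalPoly-monomial-< : ∀ {n} (s x : Cube n) → weight x < weight s → evalPoly (monomial s) x ≡ 0
evalPoly-monomial-< (true ∷ s)  (true ∷ x)  (s<s x<s) =
  trans (evalPoly-X₀*-true (monomial s) x) (evalPoly-monomial-< s x x<s)
evalPoly-monomial-< (true ∷ s)  (false ∷ x) _         = evalPoly-X₀*-false (monomial s) x
evalPoly-monomial-< (false ∷ s) (true ∷ x)  1+x<s     =
  trans (evalPoly-weaken (monomial s) true x) (evalPoly-monomial-< s x (<-trans (n<1+n _) 1+x<s))
evalPoly-monomial-< (false ∷ s) (false ∷ x) x<s       =
  trans (evalPoly-weaken (monomial s) false x) (evalPoly-monomial-< s x x<s)

∃-monomial-at : ∀ {n} (y : Cube n) {k} → k ≤ weight y → ∃[ s ] weight s ≡ k × evalPoly (monomial s) y ≡ 1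
∃-monomial-at []          z≤n = [] , refl , refl
∃-monomial-at (true ∷ y)  {zero} _ with ∃-monomial-at y z≤n
... | s , ws , ev = false ∷ s , ws , trans (evalPoly-weaken (monomial s) true y) ev
∃-monomial-at (true ∷ y)  {suc k} (s≤s k≤y) with ∃-monomial-at y k≤y
... | s , ws , ev = true ∷ s , cong suc ws , trans (evalPoly-X₀*-true (monomial s) y) ev
∃-monomial-at (false ∷ y) k≤y with ∃-monomial-at y k≤y
... | s , ws , ev = false ∷ s , ws , trans (evalPoly-weaken (monomial s) false y) ev

module _ (p : ℕ) .{{_ : NonZero p}} where

  -- pred p represents −1 in 𝔽_p.
  m+pred[p]*m≡p*m : ∀ m → m + pred p * m ≡ p * m
  m+pred[p]*m≡p*m m = cong (_* m) (suc-pred p)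

  ∣m+pred[p]*n⇒m%p≡n%p : ∀ {m n} → p ∣ m + pred p * n → m % p ≡ n % p
  ∣m+pred[p]*n⇒m%p≡n%p {m} {n} p∣m-n = begin
    m % p                      ≡⟨ [m+kn]%n≡m%n m n p ⟨
    (m + n * p) % p            ≡⟨ cong (λ q → (m + n * q) % p) (suc-pred p) ⟨
    (m + n * suc (pred p)) % p ≡⟨ cong (_% p) (regroup m n (pred p)) ⟩
    (m + pred p * n + n) % p   ≡⟨ %-remove-+ˡ n p∣m-n ⟩
    n % p                      ∎
    where
    regroup : ∀ m n q → m + n * suc q ≡ m + q * n + n
    regroup = solve-∀

  ∣-resp-% : ∀ {m n} → m % p ≡ n % p → p ∣ m → p ∣ n
  ∣-resp-% {m} {n} m%p≡n%p p∣m = m%n≡0⇒n∣m n p (trans (sym m%p≡n%p) (n∣m⇒m%n≡0 m p p∣m))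

  [1-X₀]* : ∀ {n} → Poly n → Poly (suc n)
  [1-X₀]* P = weaken P ++ scale (pred p) (X₀* P)

  evalPoly-[1-X₀]*-false : ∀ {n} (P : Poly n) x → evalPoly ([1-X₀]* P) (false ∷ x) ≡ evalPoly P x
  evalPoly-[1-X₀]*-false P x = begin
    evalPoly ([1-X₀]* P) (false ∷ x)
      ≡⟨ evalPoly-++ (weaken P) _ _ ⟩
    evalPoly (weaken P) (false ∷ x) + evalPoly (scale (pred p) (X₀* P)) (false ∷ x)
      ≡⟨ cong₂ _+_ (evalPoly-weaken P false x) (evalPoly-scale (pred p) (X₀* P) _) ⟩
    evalPoly P x + pred p * evalPoly (X₀* P) (false ∷ x)
      ≡⟨ cong (λ v → evalPoly P x + pred p * v) (evalPoly-X₀*-false P x) ⟩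
    evalPoly P x + pred p * 0
      ≡⟨ cong (evalPoly P x +_) (*-zeroʳ (pred p)) ⟩
    evalPoly P x + 0
      ≡⟨ +-identityʳ _ ⟩
    evalPoly P x
      ∎

  evalPoly-[1-X₀]*-true : ∀ {n} (P : Poly n) x → evalPoly ([1-X₀]* P) (true ∷ x) ≡ p * evalPoly P x
  evalPoly-[1-X₀]*-true P x = begin
    evalPoly ([1-X₀]* P) (true ∷ x)
      ≡⟨ evalPoly-++ (weaken P) _ _ ⟩
    evalPoly (weaken P) (true ∷ x) + evalPoly (scale (pred p) (X₀* P)) (true ∷ x)
      ≡⟨ cong₂ _+_ (evalPoly-weaken P true x) (evalPoly-scale (pred p) (X₀* P) _) ⟩
    evalPoly P x + pred p * evalPoly (X₀* P) (true ∷ x)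
      ≡⟨ cong (λ v → evalPoly P x + pred p * v) (evalPoly-X₀*-true P x) ⟩
    evalPoly P x + pred p * evalPoly P x
      ≡⟨ m+pred[p]*m≡p*m (evalPoly P x) ⟩
    p * evalPoly P x
      ∎

  DegLe-[1-X₀]* : ∀ {n d} {P : Poly n} → DegLe d P → DegLe (suc d) ([1-X₀]* P)
  DegLe-[1-X₀]* {d = d} degP = ++⁺ (DegLe-weaken (DegLe-mono (n≤1+n d) degP)) (DegLe-scale (DegLe-X₀* degP))

  -- c ∏_{e_j > 0} (1 - X_j): on the cube it agrees with c X^e at the complementary point.
  flipTerm : ∀ {n} → ℕ → Vec ℕ n → Poly n
  flipTerm c []          = constant 0 c
  flipTerm c (zero ∷ e)  = weaken (flipTerm c e)
  flipTerm c (suc _ ∷ e) = [1-X₀]* (flipTerm c e)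

  flipPoly : ∀ {n} → Poly n → Poly n
  flipPoly []             = []
  flipPoly (mono c e ∷ P) = flipTerm c e ++ flipPoly P

  evalPoly-flipTerm : ∀ {n} c (e : Vec ℕ n) x → evalPoly (flipTerm c e) x % p ≡ (c * evalExpo e (map not x)) % p
  evalPoly-flipTerm c []          []          = cong (_% p) (+-identityʳ _)
  evalPoly-flipTerm c (zero ∷ e)  (b ∷ x)     = begin
    evalPoly (weaken (flipTerm c e)) (b ∷ x) % p  ≡⟨ cong (_% p) (evalPoly-weaken (flipTerm c e) b x) ⟩
    evalPoly (flipTerm c e) x % p                 ≡⟨ evalPoly-flipTerm c e x ⟩
    (c * evalExpo e (map not x)) % p              ≡⟨ cong (λ v → (c * v) % p) (+-identityʳ _) ⟨
    (c * (1 * evalExpo e (map not x))) % p        ∎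
  evalPoly-flipTerm c (suc k ∷ e) (false ∷ x) = begin
    evalPoly ([1-X₀]* (flipTerm c e)) (false ∷ x) % p  ≡⟨ cong (_% p) (evalPoly-[1-X₀]*-false (flipTerm c e) x) ⟩
    evalPoly (flipTerm c e) x % p                      ≡⟨ evalPoly-flipTerm c e x ⟩
    (c * evalExpo e (map not x)) % p                   ≡⟨ cong (λ v → (c * v) % p) (*-identityˡ _) ⟨
    (c * (1 * evalExpo e (map not x))) % p             ≡⟨ cong (λ v → (c * (v * evalExpo e (map not x))) % p) (^-zeroˡ (suc k)) ⟨
    (c * (1 ^ suc k * evalExpo e (map not x))) % p     ∎
  evalPoly-flipTerm c (suc k ∷ e) (true ∷ x)  = begin
    evalPoly ([1-X₀]* (flipTerm c e)) (true ∷ x) % p  ≡⟨ cong (_% p) (evalPoly-[1-X₀]*-true (flipTerm c e) x) ⟩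
    (p * evalPoly (flipTerm c e) x) % p               ≡⟨ cong (_% p) (*-comm p _) ⟩
    (evalPoly (flipTerm c e) x * p) % p               ≡⟨ m*n%n≡0 (evalPoly (flipTerm c e) x) p ⟩
    0                                                 ≡⟨ m<n⇒m%n≡m (>-nonZero⁻¹ p) ⟨
    0 % p                                             ≡⟨ cong (_% p) (*-zeroʳ c) ⟨
    (c * 0) % p                                       ∎

  evalPoly-flipPoly : ∀ {n} (P : Poly n) x → evalPoly (flipPoly P) x % p ≡ evalPoly P (map not x) % p
  evalPoly-flipPoly []             x = refl
  evalPoly-flipPoly (mono c e ∷ P) x =
    trans (cong (_% p) (evalPoly-++ (flipTerm c e) _ x)) (%-cong-+ p (evalPoly-flipTerm c e x) (evalPoly-flipPoly P x))

  DegLe-flipTerm : ∀ {n} c (e : Vec ℕ n) → DegLe (totalDeg e) (flipTerm c e)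
  DegLe-flipTerm c []          = DegLe-constant 0 c 0
  DegLe-flipTerm c (zero ∷ e)  = DegLe-weaken (DegLe-flipTerm c e)
  DegLe-flipTerm c (suc k ∷ e) = DegLe-mono (s≤s (m≤n+m (totalDeg e) k)) (DegLe-[1-X₀]* (DegLe-flipTerm c e))

  DegLe-flipPoly : ∀ {n d} {P : Poly n} → DegLe d P → DegLe d (flipPoly P)
  DegLe-flipPoly {P = []}            []           = []
  DegLe-flipPoly {P = mono c e ∷ P} (e≤d ∷ degP) = ++⁺ (DegLe-mono e≤d (DegLe-flipTerm c e)) (DegLe-flipPoly degP)

  closure⇒C≡ : ∀ {n d i k} {y : Cube n} → k ≤ d → InZcl p n d (λ s → s ≡ i) y → (weight y C k) % p ≡ (i C k) % p
  closure⇒C≡ {n} {d} {i} {k} {y} k≤d y∈cl = ∣m+pred[p]*n⇒m%p≡n%p (subst (p ∣_) (evalP y) (y∈cl P degP vanishes))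
    where
    P : Poly n
    P = elementary n k ++ constant n (pred p * (i C k))
    evalP : ∀ x → evalPoly P x ≡ weight x C k + pred p * (i C k)
    evalP x = trans (evalPoly-++ (elementary n k) _ x) (cong₂ _+_ (evalPoly-elementary n k x) (evalPoly-constant n _ x))
    degP : DegLe d P
    degP = ++⁺ (DegLe-mono k≤d (DegLe-elementary n k)) (DegLe-constant n _ d)
    vanishes : ∀ x → weight x ≡ i → p ∣ evalPoly P x
    vanishes x refl = divides (i C k) (trans (evalP x) (trans (m+pred[p]*m≡p*m (i C k)) (*-comm p (i C k))))

  closure-map-not : ∀ {n d} {E E′ : ℕ → Set} {y : Cube n} → (∀ x → E (weight x) → E′ (weight (map not x))) →
                    InZcl p n d E y → InZcl p n d E′ (map not y)
  closure-map-not E⇒E′ y∈cl P degP vanishes =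
    ∣-resp-% (evalPoly-flipPoly P _) (y∈cl (flipPoly P) (DegLe-flipPoly degP)
      (λ x Ex → ∣-resp-% (sym (evalPoly-flipPoly P x)) (vanishes (map not x) (E⇒E′ x Ex))))

  module _ .{{_ : NonTrivial p}} {n d i : ℕ} where

    closure-weight-≥ : ∀ {y : Cube n} → i ≤ d → InZcl p n d (λ s → s ≡ i) y → i ≤ weight y
    closure-weight-≥ {y} i≤d y∈cl = ≮⇒≥ λ w<i → 0≢1+n (begin
      0                    ≡⟨ m<n⇒m%n≡m (>-nonZero⁻¹ p) ⟨
      0 % p                ≡⟨ cong (_% p) (k>n⇒nCk≡0 w<i) ⟨
      (weight y C i) % p   ≡⟨ closure⇒C≡ i≤d y∈cl ⟩
      (i C i) % p          ≡⟨ cong (_% p) (nCn≡1 i) ⟩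
      1 % p                ≡⟨ m<n⇒m%n≡m (nonTrivial⇒n>1 p) ⟩
      1                    ∎)

    -- a monomial of degree i + 1 over the support of y vanishes on the slice of weight i
    closure-weight-≤ : ∀ {y : Cube n} → i < d → InZcl p n d (λ s → s ≡ i) y → weight y ≤ i
    closure-weight-≤ {y} i<d y∈cl = ≮⇒≥ λ i<w → let s , ws , evs = ∃-monomial-at y i<w in
      nonTrivial⇒≢1 (∣1⇒≡1 (subst (p ∣_) evs (y∈cl (monomial s)
        (DegLe-mono (subst (_≤ d) (sym ws) i<d) (DegLe-monomial s))
        (λ x wx → subst (p ∣_) (sym (evalPoly-monomial-< s x (subst₂ _<_ (sym wx) (sym ws) (n<1+n i)))) (p ∣0)))))

    closure-weight-≡ : ∀ {y : Cube n} → i < d → InZcl p n d (λ s → s ≡ i) y → weight y ≡ i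
    closure-weight-≡ i<d y∈cl = ≤-antisym (closure-weight-≤ i<d y∈cl) (closure-weight-≥ (<⇒≤ i<d) y∈cl)

  closure-singleton : .{{NonTrivial p}} → ∀ {n d i} {y : Cube n} → d ≤ n → i ≤ n → i < d ⊎ n ∸ d < i →
                      InZcl p n d (λ s → s ≡ i) y → weight y ≡ i
  closure-singleton _ _ (inj₁ i<d) y∈cl = closure-weight-≡ i<d y∈cl
  closure-singleton {n} {d} {i} {y} d≤n i≤n (inj₂ n∸d<i) y∈cl = begin
    weight y                ≡⟨ m∸[m∸n]≡n (weight≤n y) ⟨
    n ∸ (n ∸ weight y)      ≡⟨ cong (n ∸_) (weight-map-not y) ⟨
    n ∸ weight (map not y)  ≡⟨ cong (n ∸_) (closure-weight-≡ n∸i<d ¬y∈cl) ⟩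
    n ∸ (n ∸ i)             ≡⟨ m∸[m∸n]≡n i≤n ⟩
    i                       ∎
    where
    n∸i<d : n ∸ i < d
    n∸i<d = subst (n ∸ i <_) (m∸[m∸n]≡n d≤n) (∸-monoʳ-< n∸d<i i≤n)
    ¬y∈cl : InZcl p n d (λ s → s ≡ n ∸ i) (map not y)
    ¬y∈cl = closure-map-not {E = λ s → s ≡ i} {E′ = λ s → s ≡ n ∸ i}
              (λ x wx → trans (weight-map-not x) (cong (n ∸_) wx)) y∈cl

proposition3p1 : (p n d : ℕ) → Prime p → 1 ≤ n → d ≤ n → (ℓ : ℕ) → IsCeilLog p (suc d) ℓ →
    ((i : ℕ) → i ≤ n → (i < d ⊎ n ∸ d < i) → (t : ℕ) → (ZclPt p n d i t ⇔ (t ≡ i)))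
    × ((i : ℕ) → d ≤ i → i ≤ n ∸ d → (t : ℕ) → ZclPt p n d i t → (t ≤ n × t ≡ i [mod p ^ ℓ ]))
proposition3p1 p n d p-prime _ d≤n ℓ (_ , ℓ-least) = part-a , part-b
  where
  instance
    _ = prime⇒nonZero p-prime
    _ = prime⇒nonTrivial p-prime

  part-a : (i : ℕ) → i ≤ n → (i < d ⊎ n ∸ d < i) → (t : ℕ) → (ZclPt p n d i t ⇔ (t ≡ i))
  part-a i i≤n i∉[d,n-d] t = mk⇔
    (λ (y , wy , y∈cl) → trans (sym wy) (closure-singleton p d≤n i≤n i∉[d,n-d] y∈cl))
    (λ { refl → let x , wx = ∃-weight i≤n in x , wx , λ P _ vanishes → vanishes x wx })

  p^j≤d : ∀ j → j < ℓ → p ^ j ≤ d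
  p^j≤d j j<ℓ = ≮⇒≥ λ d<p^j → <⇒≱ j<ℓ (ℓ-least j d<p^j)

  -- the bound holds for every i, not only for i ∈ [d, n - d]
  part-b : (i : ℕ) → d ≤ i → i ≤ n ∸ d → (t : ℕ) → ZclPt p n d i t → (t ≤ n × t ≡ i [mod p ^ ℓ ])
  part-b i _ _ t (y , refl , y∈cl) = weight≤n y , ≡-mod-p^-by-digits p ℓ λ j j<ℓ → begin
    digit p (weight y) j      ≡⟨ [a]C[p^j]≡digit p-prime (weight y) j ⟨
    (weight y C p ^ j) % p    ≡⟨ closure⇒C≡ p (p^j≤d j j<ℓ) y∈cl ⟩
    (i C p ^ j) % p           ≡⟨ [a]C[p^j]≡digit p-prime i j ⟩
    digit p i j               ∎
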